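{- Let $p,q\ge1$ and let $\varphi:\{1,\ldots,p+q\}\to\{1,\ldots,s\}$ be a weak $(p,q)$-quasi-shuffle. For every $\eta\in\mathrm{qsh}_\varphi(p,q)$, with $\eta:\{1,\ldots,p+q\}\to\{1,\ldots,t'\}$, there exists a unique nondecreasing surjection $\sigma[\eta]:\{1,\ldots,t'\}\to\{1,\ldots,s\}$ such that $\varphi=\sigma[\eta]\circ\eta$. Moreover, every factorization $\varphi=\sigma'\circ\eta'$ with $\eta'$ a $(p,q)$-quasi-shuffle (of any type) and $\sigma'$ a nondecreasing surjection arises this way, i.e. $\eta'\in\mathrm{qsh}_\varphi(p,q)$ and $\sigma'=\sigma[\eta']$.
   Context: For $p,q\ge1$ and $r\ge0$, a $(p,q)$-quasi-shuffle of type $r$ is a surjection $\eta:\{1,\ldots,p+q\}\to\{1,\ldots,p+q-r\}$ with $\eta_1<\cdots<\eta_p$ and $\eta_{p+1}<\cdots<\eta_{p+q}$; $\mathrm{qsh}(p,q)$ denotes the set of $(p,q)$-quasi-shuffles of all types. A weak $(p,q)$-quasi-shuffle is a surjection $\varphi:\{1,\ldots,p+q\}\to\{1,\ldots,s\}$ (for some $s$) with $\varphi_1\le\cdots\le\varphi_p$ and $\varphi_{p+1}\le\cdots\le\varphi_{p+q}$. For such $\varphi$, $\mathrm{qsh}_\varphi(p,q)$ is the set of $\eta\in\mathrm{qsh}(p,q)$ such that (1) $\varphi(a)<\varphi(b)$ implies $\eta(a)<\eta(b)$ for all $a,b\in\{1,\ldots,p+q\}$, and (2) $\varphi$ factors through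 $\eta$, i.e. $\varphi=g\circ\eta$ for some map $g$. -}

module Defs where

open import Data.Nat as ℕ using (ℕ; _+_)
open import Data.Fin using (Fin; toℕ; _≤_; _<_)
open import Data.Product using (Σ; ∃; _×_)
open import Data.Sum using (_⊎_)
open import Relation.Binary.PropositionalEquality using (_≡_)

-- Conventions: {1,…,n} is modelled by Fin n (0-based). For the domain
-- Fin (p + q), position a lies in the first block {1..p} iff toℕ a < p,
-- and in the second block {p+1..p+q} iff p ≤ toℕ a.

Surjective : ∀ {m n} → (Fin m → Fin n) → Set
Surjective {m} f = ∀ y → ∃ λ (x : Fin m) → f x ≡ y

SameBlock : (p q : ℕ) → Fin (p + q) → Fin (p + q) → Set
SameBlock p q a b = (toℕ a ℕ.< p × toℕ b ℕ.< p) ⊎ (p ℕ.≤ toℕ a × p ℕ.≤ toℕ b)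

-- (p,q)-quasi-shuffle (of some type r = p + q - t) with codomain Fin t:
-- a surjection strictly increasing on each block.
IsQuasiShuffle : (p q t : ℕ) → (Fin (p + q) → Fin t) → Set
IsQuasiShuffle p q t η =
  Surjective η × (∀ a b → SameBlock p q a b → a < b → η a < η b)

IsWeakQuasiShuffle : (p q s : ℕ) → (Fin (p + q) → Fin s) → Set
IsWeakQuasiShuffle p q s φ =
  Surjective φ × (∀ a b → SameBlock p q a b → a < b → φ a ≤ φ b)

-- η ∈ qsh_φ(p,q)  (η is assumed to be a (p,q)-quasi-shuffle separately)
InQshφ : ∀ {n s t} → (Fin n → Fin s) → (Fin n → Fin t) → Set
InQshφ {n} {s} {t} φ η =
  (∀ a b → φ a < φ b → η a < η b)
  × (Σ (Fin t → Fin s) λ g → ∀ a → φ a ≡ g (η a))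

IsNondecSurj : ∀ {t s} → (Fin t → Fin s) → Set
IsNondecSurj σ = (∀ i j → i ≤ j → σ i ≤ σ j) × Surjective σ

-- Only surjectivity and the order conditions matter: when η is surjective
-- the factor g with φ = g ∘ η is determined pointwise by φ, it is onto because
-- φ is, and it is monotone exactly when η never inverts the strict order of φ.
-- Conversely a monotone σ′ cannot map η′ a ≥ η′ b to σ′ (η′ a) < σ′ (η′ b).
module Submission where

open import Defs
open import Data.Nat using (ℕ; _+_; _≥_)
import Data.Nat.Properties as ℕ
open import Data.Fin using (Fin; _≤_; _<_)
open import Data.Product using (Σ; _×_; _,_)
open import Relation.Binary.PropositionalEquality using (_≡_; refl; sym; trans; subst₂)

module _ {n s t : ℕ} {φ : Fin n → Fin s} {η : Fin n → Fin t} where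

  factor-surjective : (g : Fin t → Fin s) → Surjective φ →
                      (∀ a → φ a ≡ g (η a)) → Surjective g
  factor-surjective g φ-surj fac y with φ-surj y
  ... | a , φa≡y = η a , trans (sym (fac a)) φa≡y

  factor-unique : Surjective η → (g g′ : Fin t → Fin s) →
                  (∀ a → φ a ≡ g (η a)) → (∀ a → φ a ≡ g′ (η a)) →
                  ∀ i → g′ i ≡ g i
  factor-unique η-surj g g′ fac fac′ i with η-surj i
  ... | a , refl = trans (sym (fac′ a)) (fac a)

  factor-monotone : Surjective η → (∀ a b → φ a < φ b → η a < η b) →
                    (g : Fin t → Fin s) → (∀ a → φ a ≡ g (η a)) →
                    ∀ i j → i ≤ j → g i ≤ g j
  factor-monotone η-surj reflects g fac i j i≤j with η-surj i | η-surj j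
  ... | a , refl | b , refl = ℕ.≮⇒≥ λ gηb<gηa →
    ℕ.<⇒≱ (reflects b a (subst₂ _<_ (sym (fac b)) (sym (fac a)) gηb<gηa)) i≤j

  monotone-factor-reflects-< : (σ : Fin t → Fin s) → (∀ i j → i ≤ j → σ i ≤ σ j) →
                               (∀ a → φ a ≡ σ (η a)) →
                               ∀ a b → φ a < φ b → η a < η b
  monotone-factor-reflects-< σ mono fac a b φa<φb = ℕ.≰⇒> λ ηb≤ηa →
    ℕ.<⇒≱ (subst₂ _<_ (fac a) (fac b) φa<φb) (mono _ _ ηb≤ηa)

proposition4p3 : (p q s : ℕ) → p ≥ 1 → q ≥ 1 →
    (φ : Fin (p + q) → Fin s) → IsWeakQuasiShuffle p q s φ →
    ((t : ℕ) (η : Fin (p + q) → Fin t) → IsQuasiShuffle p q t η → InQshφ φ η →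
      Σ (Fin t → Fin s) λ σ →
        IsNondecSurj σ × (∀ a → φ a ≡ σ (η a))
        × ((σ′ : Fin t → Fin s) → IsNondecSurj σ′ → (∀ a → φ a ≡ σ′ (η a)) →
             ∀ i → σ′ i ≡ σ i))
    ×
    ((t : ℕ) (η′ : Fin (p + q) → Fin t) (σ′ : Fin t → Fin s) →
      IsQuasiShuffle p q t η′ → IsNondecSurj σ′ → (∀ a → φ a ≡ σ′ (η′ a)) →
      InQshφ φ η′)
proposition4p3 p q s _ _ φ (φ-surj , _) =
  (λ t η (η-surj , _) (reflects , g , fac) →
     g , (factor-monotone η-surj reflects g fac , factor-surjective g φ-surj fac) , fac ,
     λ σ′ _ fac′ → factor-unique η-surj g σ′ fac fac′) ,
  (λ t η′ σ′ _ (mono , _) fac → monotone-factor-reflects-< σ′ mono fac , σ′ , fac)
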